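{- Let $\mathcal{I}=(\mathit{Sign},\mathit{Sen},\mathit{Mod},\models)$ be an inclusive institution with pullbacks of semi-inclusive cospans, and let $\frac{3}{2}\mathcal{I}=(p\mathit{Sign},p\mathit{Sen},p\mathit{Mod},\models)$. (1) If each span of signature morphisms in $\mathcal{I}$ admits a cocone, then each span of signature morphisms $(\varphi_1,\varphi_2)$ in $\frac{3}{2}\mathcal{I}$ admits a lax cocone. (2) If each span of signature morphisms in $\mathcal{I}$ admits a cocone that has model amalgamation (resp. weak model amalgamation), then each span of signature morphisms in $\frac{3}{2}\mathcal{I}$ admits a lax cocone that has model amalgamation (resp. weak model amalgamation).
   Context: An institution consists of a category $\mathit{Sign}$, functors $\mathit{Sen}\colon\mathit{Sign}\to\mathbf{SET}$, $\mathit{Mod}\colon\mathit{Sign}^{\ominus}\to\mathbf{CAT}$, and relations $\models_\Sigma$ with $M'\models\mathit{Sen}(\varphi)\rho$ iff $\mathit{Mod}(\varphi)M'\models\rho$. It is inclusive when $\mathit{Sign}$ is endowed with an inclusion system and $\mathit{Sen}$ maps abstract inclusions to set inclusions. Composition is diagrammatic. An inclusion system for a category is a pair $(\mathcal{I},\mathcal{E})$ of broad subcategories with $\mathcal{I}$ a partial order (abstract inclusions, $A\subseteq B$) such that every arrow factors uniquely as $e;i$ with $e\in\mathcal{E}$, $i\in\mathcal{I}$. A cospan is semi-inclusive if one arrow is an abstract inclusion; with such pullbacks, for any $f\colon A\to B$ and $B'\subseteq B$ there is a unique pullback square of $f$ and $B'\subseteq B$ whose side to $A$ is an abstract inclusion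 (inclusive pullback). Partial morphism $\varphi\colon\Sigma\rightharpoonup\Sigma'$: $\mathit{Sign}$-morphism $\varphi^0\colon\mathrm{dom}\,\varphi\to\Sigma'$ with $\mathrm{dom}\,\varphi\subseteq\Sigma$. Composition: inclusive pullback of $\varphi^0$ along $\mathrm{dom}\,\varphi'\subseteq\Sigma'$ with vertex $D\subseteq\mathrm{dom}\,\varphi$ and side $(\varphi^0)'$; $\mathrm{dom}(\varphi;\varphi')=D$, $(\varphi;\varphi')^0=(\varphi^0)';\varphi'^0$. Order: $\varphi\leq\theta$ iff $\mathrm{dom}\,\varphi\subseteq\mathrm{dom}\,\theta$ and $\varphi^0=(\mathrm{dom}\,\varphi\subseteq\mathrm{dom}\,\theta);\theta^0$. $p\mathit{Sign}$ has the objects of $\mathit{Sign}$ and partial morphisms as arrows. $p\mathit{Sen}(\varphi)$ is defined exactly on $\mathit{Sen}(\mathrm{dom}\,\varphi)$ by $\rho\mapsto\mathit{Sen}(\varphi^0)\rho$; $p\mathit{Mod}(\varphi)M'=\{M\mid\mathit{Mod}(\mathrm{dom}\,\varphi\subseteq\Sigma)M=\mathit{Mod}(\varphi^0)M'\}$; models and satisfaction are those of $\mathcal{I}$. In $\mathcal{I}$: a cocone for a span $\varphi_1\colon\Sigma_0\to\Sigma_1$, $\varphi_2\colon\Sigma_0\to\Sigma_2$ is a pair $\theta_k\colon\Sigma_k\to\Sigma$ with $\varphi_1;\theta_1=\varphi_2;\theta_2$; it has model amalgamation if for all $\Sigma_k$-models $M_k$ ($k=1,2$) with $\mathit{Mod}(\varphi_1)M_1=\mathit{Mod}(\varphi_2)M_2$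 there is a unique $\Sigma$-model $M$ with $\mathit{Mod}(\theta_k)M=M_k$, $k=1,2$ (weak: at least one). In $\frac{3}{2}\mathcal{I}$: a lax cocone for a span $\varphi_k\colon\Sigma_0\rightharpoonup\Sigma_k$ ($k=1,2$) is $\theta_0\colon\Sigma_0\rightharpoonup\Sigma$, $\theta_k\colon\Sigma_k\rightharpoonup\Sigma$ with $\varphi_k;\theta_k\leq\theta_0$ ($k=1,2$). A model of a diagram of partial morphisms assigns a model $M_i$ to each signature $\Sigma_i$ such that $M_i\in p\mathit{Mod}(\varphi)M_j$ for each arrow $\varphi\colon\Sigma_i\rightharpoonup\Sigma_j$ of the diagram. A lax cocone $(\theta_0,\theta_1,\theta_2)$ has model amalgamation if each model $(M_0,M_1,M_2)$ of the span admits a unique $\Sigma$-model $M$ such that $(M_0,M_1,M_2,M)$ is a model of the diagram consisting of $\varphi_1,\varphi_2,\theta_0,\theta_1,\theta_2$; weak model amalgamation requires only existence. -}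

module Defs where

open import Level using (0ℓ)
open import Data.Product using (Σ; Σ-syntax; ∃; ∃-syntax; ∃!; _×_; _,_)
open import Relation.Binary.PropositionalEquality using (_≡_; refl)
open import Function.Bundles using (_⇔_)

-- Categories (hom-sets with propositional equality), diagrammatic
-- composition  f ⨾ g  ("first f, then g").

record Category : Set₁ where
  infixr 9 _⨾_
  field
    Obj  : Set
    Hom  : Obj → Obj → Set
    id   : ∀ {A} → Hom A A
    _⨾_  : ∀ {A B C} → Hom A B → Hom B C → Hom A C
    idˡ  : ∀ {A B} (f : Hom A B) → id ⨾ f ≡ f
    idʳ  : ∀ {A B} (f : Hom A B) → f ⨾ id ≡ f
    assoc : ∀ {A B C D} (f : Hom A B) (g : Hom B C) (h : Hom C D) →
            (f ⨾ g) ⨾ h ≡ f ⨾ (g ⨾ h)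

  ≡⇒Hom : ∀ {A B} → A ≡ B → Hom A B
  ≡⇒Hom refl = id

  IsPullback : ∀ {P A B' B} (a : Hom P A) (b : Hom P B') (f : Hom A B) (g : Hom B' B) → Set
  IsPullback {P} {A} {B'} {B} a b f g =
    (a ⨾ f ≡ b ⨾ g) ×
    (∀ {Q} (x : Hom Q A) (y : Hom Q B') → x ⨾ f ≡ y ⨾ g →
       ∃! _≡_ (λ (u : Hom Q P) → (u ⨾ a ≡ x) × (u ⨾ b ≡ y)))

-- Inclusion systems.  The subcategory I of abstract inclusions is a
-- partial order on objects (A ⊆ B), embedded into the category by ι;
-- E is a broad subcategory given by the predicate IsE.

record InclusionSystem (C : Category) : Set₁ where
  open Category C
  field
    _⊆_       : Obj → Obj → Set
    ι         : ∀ {A B} → A ⊆ B → Hom A B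
    ⊆-refl    : ∀ {A} → A ⊆ A
    ⊆-trans   : ∀ {A B D} → A ⊆ B → B ⊆ D → A ⊆ D
    ⊆-antisym : ∀ {A B} → A ⊆ B → B ⊆ A → A ≡ B
    ι-refl    : ∀ {A} → ι (⊆-refl {A}) ≡ id
    ι-trans   : ∀ {A B D} (p : A ⊆ B) (q : B ⊆ D) → ι (⊆-trans p q) ≡ ι p ⨾ ι q
    ι-thin    : ∀ {A B} (p q : A ⊆ B) → ι p ≡ ι q
    IsE       : ∀ {A B} → Hom A B → Set
    E-id      : ∀ {A} → IsE (id {A})
    E-comp    : ∀ {A B D} {e : Hom A B} {e' : Hom B D} → IsE e → IsE e' → IsE (e ⨾ e')
    factor    : ∀ {A B} (f : Hom A B) →
                Σ[ D ∈ Obj ] Σ[ e ∈ Hom A D ] Σ[ p ∈ D ⊆ B ] IsE e × (f ≡ e ⨾ ι p)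
    factor-unique :
      ∀ {A B D D'} (e : Hom A D) (p : D ⊆ B) (e' : Hom A D') (p' : D' ⊆ B) →
      IsE e → IsE e' → e ⨾ ι p ≡ e' ⨾ ι p' →
      Σ[ q ∈ D ≡ D' ] (e ⨾ ≡⇒Hom q ≡ e') × (ι p ≡ ≡⇒Hom q ⨾ ι p')

  HasSemiInclusivePullbacks : Set
  HasSemiInclusivePullbacks =
    ∀ {A B B'} (f : Hom A B) (p : B' ⊆ B) →
    Σ[ P ∈ Obj ] Σ[ a ∈ Hom P A ] Σ[ b ∈ Hom P B' ] IsPullback a b f (ι p)

-- Sentence sets Sen Σ are
-- subsets of an ambient type of sentences (so that "set inclusion" makes
-- sense); Mod is recorded on objects of the model categories.

record Institution (Sign : Category) : Set₁ where
  open Category Sign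
  field
    Sentence : Set
    Sen      : Obj → Sentence → Set
    Senₘ     : ∀ {A B} → Hom A B → Sentence → Sentence
    Senₘ-∈   : ∀ {A B} (f : Hom A B) {ρ} → Sen A ρ → Sen B (Senₘ f ρ)
    Sen-id   : ∀ {A} {ρ} → Sen A ρ → Senₘ (id {A}) ρ ≡ ρ
    Sen-comp : ∀ {A B D} (f : Hom A B) (g : Hom B D) {ρ} → Sen A ρ →
               Senₘ (f ⨾ g) ρ ≡ Senₘ g (Senₘ f ρ)
    Mod      : Obj → Set
    Modₘ     : ∀ {A B} → Hom A B → Mod B → Mod A
    Mod-id   : ∀ {A} (M : Mod A) → Modₘ (id {A}) M ≡ M
    Mod-comp : ∀ {A B D} (f : Hom A B) (g : Hom B D) (M : Mod D) →
               Modₘ (f ⨾ g) M ≡ Modₘ f (Modₘ g M)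
    Sat      : (Σ₀ : Obj) → Mod Σ₀ → Sentence → Set
    satisfaction :
      ∀ {Σ₀ Σ₁} (φ : Hom Σ₀ Σ₁) (M' : Mod Σ₁) (ρ : Sentence) → Sen Σ₀ ρ →
      Sat Σ₁ M' (Senₘ φ ρ) ⇔ Sat Σ₀ (Modₘ φ M') ρ

IsInclusive : {Sign : Category} → InclusionSystem Sign → Institution Sign → Set
IsInclusive {Sign} IS Ins =
  ∀ {A B} (p : A ⊆ B) →
    (∀ ρ → Sen A ρ → Sen B ρ) × (∀ ρ → Sen A ρ → Senₘ (ι p) ρ ≡ ρ)
  where open InclusionSystem IS
        open Institution Ins

module Total {Sign : Category} (Ins : Institution Sign) where
  open Category Sign
  open Institution Ins

  record Cocone {Σ₀ Σ₁ Σ₂ : Obj} (φ₁ : Hom Σ₀ Σ₁) (φ₂ : Hom Σ₀ Σ₂) : Set where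
    field
      apex : Obj
      θ₁   : Hom Σ₁ apex
      θ₂   : Hom Σ₂ apex
      commutes : φ₁ ⨾ θ₁ ≡ φ₂ ⨾ θ₂

  module _ {Σ₀ Σ₁ Σ₂ : Obj} {φ₁ : Hom Σ₀ Σ₁} {φ₂ : Hom Σ₀ Σ₂} (c : Cocone φ₁ φ₂) where
    open Cocone c

    HasModelAmalgamation : Set
    HasModelAmalgamation =
      ∀ (M₁ : Mod Σ₁) (M₂ : Mod Σ₂) → Modₘ φ₁ M₁ ≡ Modₘ φ₂ M₂ →
      ∃! _≡_ (λ (M : Mod apex) → (Modₘ θ₁ M ≡ M₁) × (Modₘ θ₂ M ≡ M₂))

    HasWeakModelAmalgamation : Set
    HasWeakModelAmalgamation =
      ∀ (M₁ : Mod Σ₁) (M₂ : Mod Σ₂) → Modₘ φ₁ M₁ ≡ Modₘ φ₂ M₂ →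
      ∃ (λ (M : Mod apex) → (Modₘ θ₁ M ≡ M₁) × (Modₘ θ₂ M ≡ M₂))

  EverySpanHasCocone : Set
  EverySpanHasCocone =
    ∀ {Σ₀ Σ₁ Σ₂} (φ₁ : Hom Σ₀ Σ₁) (φ₂ : Hom Σ₀ Σ₂) → Cocone φ₁ φ₂

  EverySpanHasAmalgamationCocone : Set
  EverySpanHasAmalgamationCocone =
    ∀ {Σ₀ Σ₁ Σ₂} (φ₁ : Hom Σ₀ Σ₁) (φ₂ : Hom Σ₀ Σ₂) →
    Σ[ c ∈ Cocone φ₁ φ₂ ] HasModelAmalgamation c

  EverySpanHasWeakAmalgamationCocone : Set
  EverySpanHasWeakAmalgamationCocone =
    ∀ {Σ₀ Σ₁ Σ₂} (φ₁ : Hom Σ₀ Σ₁) (φ₂ : Hom Σ₀ Σ₂) →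
    Σ[ c ∈ Cocone φ₁ φ₂ ] HasWeakModelAmalgamation c

module Partial {Sign : Category} (IS : InclusionSystem Sign) (Ins : Institution Sign) where
  open Category Sign
  open InclusionSystem IS
  open Institution Ins

  record PMor (Σ₀ Σ₁ : Obj) : Set where
    field
      dom  : Obj
      dom⊆ : dom ⊆ Σ₀
      φ⁰   : Hom dom Σ₁
  open PMor public

  IsComposite : ∀ {Σ₀ Σ₁ Σ₂} → PMor Σ₀ Σ₁ → PMor Σ₁ Σ₂ → PMor Σ₀ Σ₂ → Set
  IsComposite φ φ' χ =
    Σ[ q ∈ dom χ ⊆ dom φ ] Σ[ ψ ∈ Hom (dom χ) (dom φ') ]
      IsPullback (ι q) ψ (φ⁰ φ) (ι (dom⊆ φ')) × (φ⁰ χ ≡ ψ ⨾ φ⁰ φ')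

  _≤_ : ∀ {Σ₀ Σ₁} → PMor Σ₀ Σ₁ → PMor Σ₀ Σ₁ → Set
  φ ≤ θ = Σ[ r ∈ dom φ ⊆ dom θ ] (φ⁰ φ ≡ ι r ⨾ φ⁰ θ)

  CompositeLeq : ∀ {Σ₀ Σ₁ Σ₂} → PMor Σ₀ Σ₁ → PMor Σ₁ Σ₂ → PMor Σ₀ Σ₂ → Set
  CompositeLeq φ φ' θ = Σ[ χ ∈ PMor _ _ ] IsComposite φ φ' χ × (χ ≤ θ)

  InPMod : ∀ {Σ₀ Σ₁} (φ : PMor Σ₀ Σ₁) → Mod Σ₀ → Mod Σ₁ → Set
  InPMod φ M M' = Modₘ (ι (dom⊆ φ)) M ≡ Modₘ (φ⁰ φ) M'

  record LaxCocone {Σ₀ Σ₁ Σ₂ : Obj} (φ₁ : PMor Σ₀ Σ₁) (φ₂ : PMor Σ₀ Σ₂) : Set where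
    field
      apex : Obj
      θ₀   : PMor Σ₀ apex
      θ₁   : PMor Σ₁ apex
      θ₂   : PMor Σ₂ apex
      lax₁ : CompositeLeq φ₁ θ₁ θ₀
      lax₂ : CompositeLeq φ₂ θ₂ θ₀

  module _ {Σ₀ Σ₁ Σ₂ : Obj} {φ₁ : PMor Σ₀ Σ₁} {φ₂ : PMor Σ₀ Σ₂} (c : LaxCocone φ₁ φ₂) where
    open LaxCocone c

    IsDiagramModel : Mod Σ₀ → Mod Σ₁ → Mod Σ₂ → Mod apex → Set
    IsDiagramModel M₀ M₁ M₂ M =
      InPMod φ₁ M₀ M₁ × InPMod φ₂ M₀ M₂ ×
      InPMod θ₀ M₀ M × InPMod θ₁ M₁ M × InPMod θ₂ M₂ M

    LaxHasModelAmalgamation : Set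
    LaxHasModelAmalgamation =
      ∀ (M₀ : Mod Σ₀) (M₁ : Mod Σ₁) (M₂ : Mod Σ₂) →
      InPMod φ₁ M₀ M₁ → InPMod φ₂ M₀ M₂ →
      ∃! _≡_ (λ (M : Mod apex) → IsDiagramModel M₀ M₁ M₂ M)

    LaxHasWeakModelAmalgamation : Set
    LaxHasWeakModelAmalgamation =
      ∀ (M₀ : Mod Σ₀) (M₁ : Mod Σ₁) (M₂ : Mod Σ₂) →
      InPMod φ₁ M₀ M₁ → InPMod φ₂ M₀ M₂ →
      ∃ (λ (M : Mod apex) → IsDiagramModel M₀ M₁ M₂ M)

  EveryPSpanHasLaxCocone : Set
  EveryPSpanHasLaxCocone =
    ∀ {Σ₀ Σ₁ Σ₂} (φ₁ : PMor Σ₀ Σ₁) (φ₂ : PMor Σ₀ Σ₂) → LaxCocone φ₁ φ₂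

  EveryPSpanHasAmalgamationLaxCocone : Set
  EveryPSpanHasAmalgamationLaxCocone =
    ∀ {Σ₀ Σ₁ Σ₂} (φ₁ : PMor Σ₀ Σ₁) (φ₂ : PMor Σ₀ Σ₂) →
    Σ[ c ∈ LaxCocone φ₁ φ₂ ] LaxHasModelAmalgamation c

  EveryPSpanHasWeakAmalgamationLaxCocone : Set
  EveryPSpanHasWeakAmalgamationLaxCocone =
    ∀ {Σ₀ Σ₁ Σ₂} (φ₁ : PMor Σ₀ Σ₁) (φ₂ : PMor Σ₀ Σ₂) →
    Σ[ c ∈ LaxCocone φ₁ φ₂ ] LaxHasWeakModelAmalgamation c

module Submission where

-- A partial span φ₁, φ₂ is closed by total morphisms, built from two cocones
-- in I.  The first closes φ₁⁰ and dom φ₁ ⊆ Σ₀, giving t₁ : Σ₁ → A and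
-- τ : Σ₀ → A; the second closes (dom φ₂ ⊆ Σ₀) ⨾ τ and φ₂⁰, giving σ : A → B
-- and t₂ : Σ₂ → B.  The lax cocone is θ₀ = τ ⨾ σ, θ₁ = t₁ ⨾ σ, θ₂ = t₂.
-- Composing with a total morphism restricts no domain, so the laxness
-- conditions are the commutations of the two cocones, and a model of the
-- diagram is obtained by amalgamating twice.

open import Defs
open import Data.Product using (_×_; _,_; proj₁; proj₂; ∃!)
open import Relation.Binary.PropositionalEquality
  using (_≡_; refl; sym; trans; cong; module ≡-Reasoning)

∃!-unique : {A : Set} {P : A → Set} → ∃! _≡_ P → ∀ {x y} → P x → P y → x ≡ y
∃!-unique (_ , _ , unique) px py = trans (sym (unique px)) (unique py)

module _ {C : Category} where
  open Category C

  isPullback-id : ∀ {A B} (f : Hom A B) → IsPullback id f f id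
  isPullback-id f =
      trans (idˡ f) (sym (idʳ f))
    , λ x y x⨾f≡y → x , (idʳ x , trans x⨾f≡y (idʳ y))
                      , λ {u} (u⨾id≡x , _) → trans (sym u⨾id≡x) (idʳ u)

module _ {C : Category} (IS : InclusionSystem C) where
  open Category C
  open InclusionSystem IS

  isPullback-ι-refl : ∀ {A B} (f : Hom A B) → IsPullback (ι ⊆-refl) f f (ι ⊆-refl)
  isPullback-ι-refl {A} {B} f rewrite ι-refl {A} | ι-refl {B} = isPullback-id {C} f

module _ {Sign : Category} (Ins : Institution Sign) where
  open Category Sign using (Hom)
  open Total Ins

  amalgamation⇒weak : ∀ {Σ₀ Σ₁ Σ₂} {φ₁ : Hom Σ₀ Σ₁} {φ₂ : Hom Σ₀ Σ₂} (c : Cocone φ₁ φ₂) →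
                      HasModelAmalgamation c → HasWeakModelAmalgamation c
  amalgamation⇒weak c am M₁ M₂ agree with am M₁ M₂ agree
  ... | M , reducts , _ = M , reducts

module _ {Sign : Category} (IS : InclusionSystem Sign) (Ins : Institution Sign) where
  open Category Sign
  open InclusionSystem IS
  open Institution Ins
  open Total Ins
  open Partial IS Ins

  total : ∀ {A B} → Hom A B → PMor A B
  total {A} f = record { dom = A ; dom⊆ = ⊆-refl ; φ⁰ = f }

  infixl 30 _⨾ᵗ_
  _⨾ᵗ_ : ∀ {Σ₀ Σ₁ Σ₂} → PMor Σ₀ Σ₁ → Hom Σ₁ Σ₂ → PMor Σ₀ Σ₂
  φ ⨾ᵗ θ = record { dom = dom φ ; dom⊆ = dom⊆ φ ; φ⁰ = φ⁰ φ ⨾ θ }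

  isComposite-total : ∀ {Σ₀ Σ₁ Σ₂} (φ : PMor Σ₀ Σ₁) (θ : Hom Σ₁ Σ₂) →
                      IsComposite φ (total θ) (φ ⨾ᵗ θ)
  isComposite-total φ θ = ⊆-refl , φ⁰ φ , isPullback-ι-refl IS (φ⁰ φ) , refl

  compositeLeq-total : ∀ {Σ₀ Σ₁ Σ₂} (φ : PMor Σ₀ Σ₁) (θ : Hom Σ₁ Σ₂) (θ₀ : PMor Σ₀ Σ₂) →
                       φ ⨾ᵗ θ ≤ θ₀ → CompositeLeq φ (total θ) θ₀
  compositeLeq-total φ θ θ₀ φ⨾θ≤θ₀ = φ ⨾ᵗ θ , isComposite-total φ θ , φ⨾θ≤θ₀

  Modₘ-ι-refl : ∀ {A} (M : Mod A) → Modₘ (ι ⊆-refl) M ≡ M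
  Modₘ-ι-refl M = trans (cong (λ i → Modₘ i M) ι-refl) (Mod-id M)

  inPMod-total⁺ : ∀ {A B} (f : Hom A B) {M N} → Modₘ f N ≡ M → InPMod (total f) M N
  inPMod-total⁺ f {M} fN≡M = trans (Modₘ-ι-refl M) (sym fN≡M)

  inPMod-total⁻ : ∀ {A B} (f : Hom A B) {M N} → InPMod (total f) M N → Modₘ f N ≡ M
  inPMod-total⁻ f {M} M∈ = sym (trans (sym (Modₘ-ι-refl M)) M∈)

  module TwoStepCocone {Σ₀ Σ₁ Σ₂} (φ₁ : PMor Σ₀ Σ₁) (φ₂ : PMor Σ₀ Σ₂)
      (c₁ : Cocone (φ⁰ φ₁) (ι (dom⊆ φ₁)))
      (c₂ : Cocone (ι (dom⊆ φ₂) ⨾ Cocone.θ₂ c₁) (φ⁰ φ₂)) where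
    open Cocone c₁ using () renaming (θ₁ to t₁; θ₂ to τ)
    open Cocone c₂ using () renaming (θ₁ to σ; θ₂ to t₂)

    laxCocone : LaxCocone φ₁ φ₂
    laxCocone = record
      { apex = Cocone.apex c₂
      ; θ₀   = total (τ ⨾ σ)
      ; θ₁   = total (t₁ ⨾ σ)
      ; θ₂   = total t₂
      ; lax₁ = compositeLeq-total φ₁ (t₁ ⨾ σ) (total (τ ⨾ σ)) (dom⊆ φ₁ , lax₁)
      ; lax₂ = compositeLeq-total φ₂ t₂ (total (τ ⨾ σ)) (dom⊆ φ₂ , lax₂)
      }
      where
      open ≡-Reasoning
      lax₁ : φ⁰ φ₁ ⨾ (t₁ ⨾ σ) ≡ ι (dom⊆ φ₁) ⨾ (τ ⨾ σ)
      lax₁ = begin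
        φ⁰ φ₁ ⨾ (t₁ ⨾ σ)         ≡⟨ sym (assoc _ _ _) ⟩
        (φ⁰ φ₁ ⨾ t₁) ⨾ σ         ≡⟨ cong (_⨾ σ) (Cocone.commutes c₁) ⟩
        (ι (dom⊆ φ₁) ⨾ τ) ⨾ σ    ≡⟨ assoc _ _ _ ⟩
        ι (dom⊆ φ₁) ⨾ (τ ⨾ σ)    ∎
      lax₂ : φ⁰ φ₂ ⨾ t₂ ≡ ι (dom⊆ φ₂) ⨾ (τ ⨾ σ)
      lax₂ = trans (sym (Cocone.commutes c₂)) (assoc _ _ _)

    τ-reduct-agrees : ∀ {M₀ M₂ N} → Modₘ τ N ≡ M₀ → InPMod φ₂ M₀ M₂ →
                      Modₘ (ι (dom⊆ φ₂) ⨾ τ) N ≡ Modₘ (φ⁰ φ₂) M₂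
    τ-reduct-agrees {M₀} {M₂} {N} τN≡M₀ M₀∈ = begin
      Modₘ (ι (dom⊆ φ₂) ⨾ τ) N          ≡⟨ Mod-comp _ _ N ⟩
      Modₘ (ι (dom⊆ φ₂)) (Modₘ τ N)     ≡⟨ cong (Modₘ (ι (dom⊆ φ₂))) τN≡M₀ ⟩
      Modₘ (ι (dom⊆ φ₂)) M₀             ≡⟨ M₀∈ ⟩
      Modₘ (φ⁰ φ₂) M₂                   ∎
      where open ≡-Reasoning

    module _ {M₀ : Mod Σ₀} {M₁ : Mod Σ₁} {M₂ : Mod Σ₂} where

      reducts⇒isDiagramModel : ∀ {M} → InPMod φ₁ M₀ M₁ → InPMod φ₂ M₀ M₂ →
        Modₘ t₁ (Modₘ σ M) ≡ M₁ → Modₘ τ (Modₘ σ M) ≡ M₀ → Modₘ t₂ M ≡ M₂ →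
        IsDiagramModel laxCocone M₀ M₁ M₂ M
      reducts⇒isDiagramModel {M} M₀∈₁ M₀∈₂ t₁σM≡M₁ τσM≡M₀ t₂M≡M₂ =
          M₀∈₁ , M₀∈₂
        , inPMod-total⁺ (τ ⨾ σ) (trans (Mod-comp τ σ M) τσM≡M₀)
        , inPMod-total⁺ (t₁ ⨾ σ) (trans (Mod-comp t₁ σ M) t₁σM≡M₁)
        , inPMod-total⁺ t₂ t₂M≡M₂

      isDiagramModel⇒reducts : ∀ {M} → IsDiagramModel laxCocone M₀ M₁ M₂ M →
        (Modₘ t₁ (Modₘ σ M) ≡ M₁) × (Modₘ τ (Modₘ σ M) ≡ M₀) × (Modₘ t₂ M ≡ M₂)
      isDiagramModel⇒reducts {M} (_ , _ , M₀∈ , M₁∈ , M₂∈) =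
          trans (sym (Mod-comp t₁ σ M)) (inPMod-total⁻ (t₁ ⨾ σ) M₁∈)
        , trans (sym (Mod-comp τ σ M)) (inPMod-total⁻ (τ ⨾ σ) M₀∈)
        , inPMod-total⁻ t₂ M₂∈

    weakAmalgamation : HasWeakModelAmalgamation c₁ → HasWeakModelAmalgamation c₂ →
                       LaxHasWeakModelAmalgamation laxCocone
    weakAmalgamation am₁ am₂ M₀ M₁ M₂ M₀∈₁ M₀∈₂ with am₁ M₁ M₀ (sym M₀∈₁)
    ... | N , t₁N≡M₁ , τN≡M₀ with am₂ N M₂ (τ-reduct-agrees τN≡M₀ M₀∈₂)
    ... | M , σM≡N , t₂M≡M₂ =
      M , reducts⇒isDiagramModel M₀∈₁ M₀∈₂
            (trans (cong (Modₘ t₁) σM≡N) t₁N≡M₁)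
            (trans (cong (Modₘ τ) σM≡N) τN≡M₀)
            t₂M≡M₂

    diagramModel-unique : HasModelAmalgamation c₁ → HasModelAmalgamation c₂ →
      ∀ {M₀ M₁ M₂ M M'} → IsDiagramModel laxCocone M₀ M₁ M₂ M →
      IsDiagramModel laxCocone M₀ M₁ M₂ M' → M ≡ M'
    diagramModel-unique am₁ am₂ {M₀} {M₁} {M₂} {M} {M'} model model' =
      ∃!-unique (am₂ (Modₘ σ M) M₂ (τ-reduct-agrees τσM≡M₀ M₀∈₂))
        (refl , t₂M≡M₂) (sym σM≡σM' , t₂M'≡M₂)
      where
      M₀∈₁ = proj₁ model
      M₀∈₂ = proj₁ (proj₂ model)
      reducts  = isDiagramModel⇒reducts model
      reducts' = isDiagramModel⇒reducts model'
      τσM≡M₀ = proj₁ (proj₂ reducts)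
      t₂M≡M₂ = proj₂ (proj₂ reducts)
      t₂M'≡M₂ = proj₂ (proj₂ reducts')
      σM≡σM' : Modₘ σ M ≡ Modₘ σ M'
      σM≡σM' = ∃!-unique (am₁ M₁ M₀ (sym M₀∈₁))
        (proj₁ reducts , τσM≡M₀) (proj₁ reducts' , proj₁ (proj₂ reducts'))

    amalgamation : HasModelAmalgamation c₁ → HasModelAmalgamation c₂ →
                   LaxHasModelAmalgamation laxCocone
    amalgamation am₁ am₂ M₀ M₁ M₂ M₀∈₁ M₀∈₂
      with weakAmalgamation (amalgamation⇒weak Ins c₁ am₁) (amalgamation⇒weak Ins c₂ am₂)
                            M₀ M₁ M₂ M₀∈₁ M₀∈₂
    ... | M , model = M , model , diagramModel-unique am₁ am₂ model

mainTheorem8 : (Sign : Category) (IS : InclusionSystem Sign) (Ins : Institution Sign) →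
    IsInclusive IS Ins →
    InclusionSystem.HasSemiInclusivePullbacks IS →
    (Total.EverySpanHasCocone Ins → Partial.EveryPSpanHasLaxCocone IS Ins)
    × (Total.EverySpanHasAmalgamationCocone Ins → Partial.EveryPSpanHasAmalgamationLaxCocone IS Ins)
    × (Total.EverySpanHasWeakAmalgamationCocone Ins → Partial.EveryPSpanHasWeakAmalgamationLaxCocone IS Ins)
mainTheorem8 Sign IS Ins _ _ =
    (λ cocone φ₁ φ₂ →
       let c₁ = cocone (φ⁰ φ₁) (ι (dom⊆ φ₁))
       in  laxCocone φ₁ φ₂ c₁ (cocone (ι (dom⊆ φ₂) ⨾ Cocone.θ₂ c₁) (φ⁰ φ₂)))
  , (λ cocone φ₁ φ₂ →
       let (c₁ , am₁) = cocone (φ⁰ φ₁) (ι (dom⊆ φ₁))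
           (c₂ , am₂) = cocone (ι (dom⊆ φ₂) ⨾ Cocone.θ₂ c₁) (φ⁰ φ₂)
       in  laxCocone φ₁ φ₂ c₁ c₂ , amalgamation φ₁ φ₂ c₁ c₂ am₁ am₂)
  , (λ cocone φ₁ φ₂ →
       let (c₁ , am₁) = cocone (φ⁰ φ₁) (ι (dom⊆ φ₁))
           (c₂ , am₂) = cocone (ι (dom⊆ φ₂) ⨾ Cocone.θ₂ c₁) (φ⁰ φ₂)
       in  laxCocone φ₁ φ₂ c₁ c₂ , weakAmalgamation φ₁ φ₂ c₁ c₂ am₁ am₂)
  where
  open Category Sign
  open InclusionSystem IS
  open Total Ins
  open Partial IS Ins
  open TwoStepCocone IS Ins
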